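{- Let $t$ be an arbor on a finite set $I$. Then the polytope $Q_t\subset\mathbb{R}^I$ has no interior lattice point, i.e. no point of $\mathbb{Z}^I$ lies in the interior of $Q_t$.
   Context: An arbor on a finite non-empty set $I$ is a rooted tree whose vertices are labeled by pairwise disjoint non-empty subsets of $I$ whose union is $I$; we identify a vertex with its label set. For a vertex $v$, $\mathscr{D}(v)\subseteq I$ is the union of the labels of all vertices $w$ whose path to the root passes through $v$ (including $v$ itself). The polytope $Q_t\subset \mathbb{R}^I$ is defined by the inequalities $x_i\ge 0$ for all $i\in I$ and $\sum_{i\in\mathscr{D}(v)}x_i\le|\mathscr{D}(v)|$ for every vertex $v$ of $t$. -}

module Defs where

open import Data.Nat using (ℕ; zero; suc)
open import Data.Bool using (Bool; true; false; if_then_else_)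
open import Data.Fin using (Fin; zero; suc)
open import Data.Fin.Subset using (Subset; _∪_; _∩_; ⊥; ⊤; Nonempty; Empty; ∣_∣)
open import Data.Vec using ([]; _∷_)
open import Data.List using (List; []; _∷_; _++_)
open import Data.List.Relation.Unary.All using (All)
open import Data.List.Relation.Unary.AllPairs using (AllPairs)
open import Data.Integer using (ℤ; +_; _+_; _<_)
open import Data.Product using (Σ; _×_)
open import Relation.Binary.PropositionalEquality using (_≡_)

-- A rooted tree whose vertices carry labels that are subsets of I = Fin n.
-- A vertex is identified with the subtree rooted at it.
data Tree (n : ℕ) : Set where
  node : Subset n → List (Tree n) → Tree n

label : ∀ {n} → Tree n → Subset n
label (node s _) = s

mutual
  vertices : ∀ {n} → Tree n → List (Tree n)
  vertices (node s ts) = node s ts ∷ verticesF ts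

  verticesF : ∀ {n} → List (Tree n) → List (Tree n)
  verticesF [] = []
  verticesF (t ∷ ts) = vertices t ++ verticesF ts

  desc : ∀ {n} → Tree n → Subset n
  desc (node s ts) = s ∪ descF ts

  descF : ∀ {n} → List (Tree n) → Subset n
  descF [] = ⊥
  descF (t ∷ ts) = desc t ∪ descF ts

labels : ∀ {n} → Tree n → List (Subset n)
labels t = Data.List.map label (vertices t)

record IsArbor {n : ℕ} (t : Tree n) : Set where
  field
    nonempty : All Nonempty (labels t)
    disjoint : AllPairs (λ a b → Empty (a ∩ b)) (labels t)
    covers   : Data.Fin.Subset.⋃ (labels t) ≡ ⊤

sumOver : ∀ {n} → Subset n → (Fin n → ℤ) → ℤ
sumOver [] x = + 0
sumOver (b ∷ p) x = (if b then x zero else + 0) + sumOver p (λ i → x (suc i))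

-- x ∈ ℤ^I lies in the interior of Q_t: all defining inequalities strict
-- (Q_t is full-dimensional, containing a small cube near 0).
InInteriorQ : ∀ {n} → Tree n → (Fin n → ℤ) → Set
InInteriorQ t x =
  ((i : Fin _) → + 0 < x i) ×
  All (λ v → sumOver (desc v) x < + ∣ desc v ∣) (vertices t)

{-# OPTIONS --safe #-}
module Submission where

open import Defs
open import Data.Nat using (ℕ)
open import Data.Fin using (Fin; zero; suc)
open import Data.Fin.Subset using (Subset; ∣_∣)
open import Data.Bool using (true; false)
open import Data.Vec using ([]; _∷_)
open import Data.Integer using (ℤ; +_; _≤_; _<_)
open import Data.Integer.Properties using (+-mono-≤; ≤-refl; <⇒≱; i<j⇒suc[i]≤j)
open import Data.List.Relation.Unary.All using (_∷_)
open import Data.Product using (Σ; _,_)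
open import Function using (_∘_)
open import Relation.Nullary using (¬_)

positive⇒∣∣≤sumOver : ∀ {n} (S : Subset n) {x : Fin n → ℤ} →
                      (∀ i → + 0 < x i) → + ∣ S ∣ ≤ sumOver S x
positive⇒∣∣≤sumOver []          positive = ≤-refl
positive⇒∣∣≤sumOver (true  ∷ S) positive =
  +-mono-≤ (i<j⇒suc[i]≤j (positive zero)) (positive⇒∣∣≤sumOver S (positive ∘ suc))
positive⇒∣∣≤sumOver (false ∷ S) positive =
  +-mono-≤ (≤-refl {+ 0}) (positive⇒∣∣≤sumOver S (positive ∘ suc))

-- Already the inequality at the root cannot hold strictly, since every
-- coordinate of an interior lattice point is at least 1.
lemma1p4 : (n : ℕ) (t : Tree n) → IsArbor t →
    ¬ Σ (Fin n → ℤ) (λ x → InInteriorQ t x)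
lemma1p4 n t@(node _ _) _ (x , positive , rootBound ∷ _) =
  <⇒≱ rootBound (positive⇒∣∣≤sumOver (desc t) positive)
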